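{- Let $n\ge6$ and $r$ be positive integers such that $K_r=2^{2r}-2^r+1$ is invertible modulo $2^n-1$, and let $K_r^{ -1}$ be the least positive residue of its inverse modulo $2^n-1$. Then $\mathrm{wt}(K_r^{ -1})=2$ if and only if $n=\frac{3r}{b}$ for some positive divisor $b$ of $r$ with $\gcd(b,3)=1$. In these cases $$K_r^{ -1}\equiv\begin{cases}2^{n-1}+2^{\frac n3-1}&\text{if }b\equiv1\pmod3,\\ 2^{n-1}+2^{\frac{2n}{3}-1}&\text{if }b\equiv2\pmod3,\end{cases}\pmod{2^n-1}.$$
   Context: $\mathrm{wt}(m)$ is the number of ones in the binary expansion of $m$. -}

module Defs where

open import Data.Nat using (ℕ; zero; suc; _+_; _*_; _∸_; _^_; _%_; _/_)
open import Data.Integer as ℤ using (ℤ; +_)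
open import Data.Integer.Divisibility as ℤD using ()

-- Hamming weight: number of ones in the binary expansion of m.
-- Fuel f ≥ number of bits suffices; fuel m is always enough.
wtAux : ℕ → ℕ → ℕ
wtAux zero    _ = 0
wtAux (suc f) m = m % 2 + wtAux f (m / 2)

wt : ℕ → ℕ
wt m = wtAux m m

-- K_r = 2^{2r} - 2^r + 1  (the subtraction never truncates since 2^{2r} ≥ 2^r)
K : ℕ → ℕ
K r = 2 ^ (2 * r) ∸ 2 ^ r + 1

_≡_[mod_] : ℕ → ℕ → ℕ → Set
a ≡ b [mod m ] = (+ m) ℤD.∣ ((+ a) ℤ.- (+ b))

infix 4 _≡_[mod_]

module Submission where

-- Write u = 2^r and M = 2^n − 1, so that 2^n ≡ 1 (mod M) and (u + 1)·K r = u³ + 1.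
-- If n b = 3 r then u³ ≡ 1, hence 2x ≡ (u + 1)·K r·x ≡ u + 1 and x ≡ 2^(n−1)·(2^r + 1); reducing the
-- exponent n − 1 + r modulo n gives the two closed forms, both of weight 2.
-- Conversely, for x = 2^i + 2^(i+d) multiplying K r·x ≡ 1 by (u + 1)·2^(n−i) gives
-- 2^a + 2^(a+d) + 2^0 + 2^d ≡ 2^(r+n−i) + 2^(n−i) with a ≡ 3r (mod n). Binary expansions modulo M are
-- unique, so unless n ∣ 3r the four powers must collapse onto two, which forces r ≡ ±3 and 3r ≡ ±1
-- (mod n). Then n ∣ 8 or n ∣ 10, so n is even, r is odd, and 3 divides both K r and M.
-- Finally n ∤ r, for otherwise x ≡ 1; hence b = 3r/n is prime to 3.

open import Defs
open import Data.Nat using (ℕ; _+_; _*_; _∸_; _^_; _%_; _/_; _≤_; _<_)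
open import Data.Nat.Divisibility using (_∣_)
open import Data.Nat.GCD using (gcd)
open import Data.Nat.Coprimality using (Coprime)
open import Data.Product using (_×_; ∃-syntax)
open import Function.Bundles using (_⇔_)
open import Relation.Binary.PropositionalEquality using (_≡_)

open import Data.Empty using (⊥; ⊥-elim)
open import Data.List using (List; []; _∷_)
open import Data.List.Membership.Propositional using (_∈_)
open import Data.List.Relation.Binary.Subset.Propositional using (_⊆_)
open import Data.List.Relation.Unary.All using (All; []; _∷_)
open import Data.List.Relation.Unary.Any using (here; there)
open import Data.List.Relation.Unary.Unique.Propositional using (Unique; []; _∷_)
open import Data.Nat using (zero; suc; s≤s; z≤n; NonZero; _≟_; ≢-nonZero⁻¹)
open import Data.Nat.Coprimality using (coprime-divisor; gcd≡1⇒coprime) renaming (sym to Coprime-sym)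
open import Data.Nat.DivMod
open import Data.Nat.Divisibility using (divides; ∣⇒≤; ∣-trans; ∣-refl; ∣1⇒≡1; n∣m⇒m%n≡0; m%n≡0⇒n∣m; >⇒∤)
open import Data.Nat.GCD using (gcd[m,n]∣m; gcd[m,n]∣n; gcd-greatest)
open import Data.Nat.Primality using (Prime; prime?; prime⇒irreducible)
open import Data.Nat.Properties
open import Data.Nat.Tactic.RingSolver using (solve-∀)
open import Data.Product using (_,_; ∃₂; proj₁; proj₂; uncurry)
import Data.Product as Product
open import Data.Sum using (_⊎_; inj₁; inj₂)
open import Function using (_∘_)
open import Function.Bundles using (mk⇔)
open import Level using (0ℓ)
open import Relation.Binary.Bundles using (Setoid)
open import Relation.Binary.PropositionalEquality using (_≢_; refl; sym; trans; cong; cong₂; subst; subst₂; module ≡-Reasoning)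
import Relation.Binary.Reasoning.Setoid as SetoidReasoning
open import Relation.Nullary using (¬_; contradiction; yes; no)
open import Relation.Nullary.Decidable using (from-yes)

wtAux-zero : ∀ f → wtAux f 0 ≡ 0
wtAux-zero zero    = refl
wtAux-zero (suc f) = wtAux-zero f

[b+m*2]%2≡b : ∀ {b} m → b < 2 → (b + m * 2) % 2 ≡ b
[b+m*2]%2≡b {b} m b<2 = trans ([m+kn]%n≡m%n b m 2) (m<n⇒m%n≡m b<2)

[b+m*2]/2≡m : ∀ {b} m → b < 2 → (b + m * 2) / 2 ≡ m
[b+m*2]/2≡m {b} m b<2 = trans (+-distrib-/-∣ʳ b (divides m refl)) (cong₂ _+_ (m<n⇒m/n≡0 b<2) (m*n/n≡m m 2))

parity-unique : ∀ {b c m h} → b < 2 → c < 2 → b + m * 2 ≡ c + h * 2 → b ≡ c × m ≡ h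
parity-unique {b} {c} {m} {h} b<2 c<2 eq =
  trans (sym ([b+m*2]%2≡b m b<2)) (trans (cong (_% 2) eq) ([b+m*2]%2≡b h c<2)) ,
  trans (sym ([b+m*2]/2≡m m b<2)) (trans (cong (_/ 2) eq) ([b+m*2]/2≡m h c<2))

wtAux-step : ∀ f {b} m → b < 2 → wtAux (suc f) (b + m * 2) ≡ b + wtAux f m
wtAux-step f m b<2 = cong₂ (λ p q → p + wtAux f q) ([b+m*2]%2≡b m b<2) ([b+m*2]/2≡m m b<2)

halve-≤ : ∀ b m {f} → b + m * 2 ≤ suc f → m ≤ f
halve-≤ b zero    _  = z≤n
halve-≤ b (suc m) le = ≤-trans (s≤s (m≤m*n m 2)) (≤-pred (≤-trans (m≤n+m (suc m * 2) b) le))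

halves : ∀ m → ∃₂ λ b h → b < 2 × m ≡ b + h * 2
halves m = m % 2 , m / 2 , m%n<n m 2 , m≡m%n+[m/n]*n m 2

wtAux-2^ : ∀ f i → 2 ^ i ≤ f → wtAux f (2 ^ i) ≡ 1
wtAux-2^ zero    i       le = contradiction le (<⇒≱ (m^n>0 2 i))
wtAux-2^ (suc f) zero    _  = cong suc (wtAux-zero f)
wtAux-2^ (suc f) (suc i) le = begin
  wtAux (suc f) (2 * 2 ^ i)     ≡⟨ cong (wtAux (suc f)) (*-comm 2 (2 ^ i)) ⟩
  wtAux (suc f) (0 + 2 ^ i * 2) ≡⟨ wtAux-step f (2 ^ i) (s≤s z≤n) ⟩
  wtAux f (2 ^ i)               ≡⟨ wtAux-2^ f i (halve-≤ 0 (2 ^ i) (subst (_≤ suc f) (*-comm 2 (2 ^ i)) le)) ⟩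
  1                             ∎
  where open ≡-Reasoning

wtAux-2^+2^ : ∀ f i j → i < j → 2 ^ i + 2 ^ j ≤ f → wtAux f (2 ^ i + 2 ^ j) ≡ 2
wtAux-2^+2^ zero i j _ le = contradiction le (<⇒≱ (≤-trans (m^n>0 2 i) (m≤m+n _ _)))
wtAux-2^+2^ (suc f) zero (suc j) _ le = begin
  wtAux (suc f) (1 + 2 * 2 ^ j)     ≡⟨ cong (λ y → wtAux (suc f) (1 + y)) (*-comm 2 (2 ^ j)) ⟩
  wtAux (suc f) (1 + 2 ^ j * 2)     ≡⟨ wtAux-step f (2 ^ j) ≤-refl ⟩
  1 + wtAux f (2 ^ j)               ≡⟨ cong suc (wtAux-2^ f j 2^j≤f) ⟩
  2                                 ∎
  where
  open ≡-Reasoning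
  2^j≤f : 2 ^ j ≤ f
  2^j≤f = halve-≤ 1 (2 ^ j) (subst (λ y → 1 + y ≤ suc f) (*-comm 2 (2 ^ j)) le)
wtAux-2^+2^ (suc f) (suc i) (suc j) (s≤s i<j) le = begin
  wtAux (suc f) (2 * 2 ^ i + 2 * 2 ^ j)   ≡⟨ cong (wtAux (suc f)) (double (2 ^ i) (2 ^ j)) ⟩
  wtAux (suc f) (0 + (2 ^ i + 2 ^ j) * 2) ≡⟨ wtAux-step f (2 ^ i + 2 ^ j) (s≤s z≤n) ⟩
  wtAux f (2 ^ i + 2 ^ j)                 ≡⟨ wtAux-2^+2^ f i j i<j 2^i+2^j≤f ⟩
  2                                       ∎
  where
  open ≡-Reasoning
  double : ∀ x y → 2 * x + 2 * y ≡ 0 + (x + y) * 2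
  double = solve-∀
  2^i+2^j≤f : 2 ^ i + 2 ^ j ≤ f
  2^i+2^j≤f = halve-≤ 0 _ (subst (_≤ suc f) (double (2 ^ i) (2 ^ j)) le)

wt-2^+2^ : ∀ {i j} → i < j → wt (2 ^ i + 2 ^ j) ≡ 2
wt-2^+2^ {i} {j} i<j = wtAux-2^+2^ _ i j i<j ≤-refl

wtAux≡0⇒≡0 : ∀ f m → m ≤ f → wtAux f m ≡ 0 → m ≡ 0
wtAux≡0⇒≡0 zero    m m≤f _ = n≤0⇒n≡0 m≤f
wtAux≡0⇒≡0 (suc f) m m≤f w with halves m
... | 0 , h , _ , refl =
  cong (_* 2) (wtAux≡0⇒≡0 f h (halve-≤ 0 h m≤f) (trans (sym (wtAux-step f h (s≤s z≤n))) w))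
... | 1 , h , _ , refl with () ← trans (sym (wtAux-step f h ≤-refl)) w
... | suc (suc _) , _ , s≤s (s≤s ()) , _

wtAux≡1⇒2^ : ∀ f m → m ≤ f → wtAux f m ≡ 1 → ∃[ i ] m ≡ 2 ^ i
wtAux≡1⇒2^ zero    _ _   ()
wtAux≡1⇒2^ (suc f) m m≤f w with halves m
... | 0 , h , _ , refl with wtAux≡1⇒2^ f h (halve-≤ 0 h m≤f) (trans (sym (wtAux-step f h (s≤s z≤n))) w)
...   | i , refl = suc i , *-comm (2 ^ i) 2
wtAux≡1⇒2^ (suc f) m m≤f w | 1 , h , _ , refl
  with refl ← wtAux≡0⇒≡0 f h (halve-≤ 1 h m≤f) (suc-injective (trans (sym (wtAux-step f h ≤-refl)) w))
  = 0 , refl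
wtAux≡1⇒2^ (suc f) m m≤f w | suc (suc _) , _ , s≤s (s≤s ()) , _

wtAux≡2⇒2^+2^ : ∀ f m → m ≤ f → wtAux f m ≡ 2 → ∃₂ λ i j → i < j × m ≡ 2 ^ i + 2 ^ j
wtAux≡2⇒2^+2^ zero    _ _   ()
wtAux≡2⇒2^+2^ (suc f) m m≤f w with halves m
... | 0 , h , _ , refl with wtAux≡2⇒2^+2^ f h (halve-≤ 0 h m≤f) (trans (sym (wtAux-step f h (s≤s z≤n))) w)
...   | i , j , i<j , refl = suc i , suc j , s≤s i<j , double (2 ^ i) (2 ^ j)
  where
  double : ∀ x y → (x + y) * 2 ≡ 2 * x + 2 * y
  double = solve-∀
wtAux≡2⇒2^+2^ (suc f) m m≤f w | 1 , h , _ , refl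
  with j , refl ← wtAux≡1⇒2^ f h (halve-≤ 1 h m≤f) (suc-injective (trans (sym (wtAux-step f h ≤-refl)) w))
  = 0 , suc j , s≤s z≤n , cong suc (*-comm (2 ^ j) 2)
wtAux≡2⇒2^+2^ (suc f) m m≤f w | suc (suc _) , _ , s≤s (s≤s ()) , _

wt≡2⇒2^+2^ : ∀ m → wt m ≡ 2 → ∃₂ λ i j → i < j × m ≡ 2 ^ i + 2 ^ j
wt≡2⇒2^+2^ m = wtAux≡2⇒2^+2^ m m ≤-refl

-- The congruence of Defs wrapped in a record, so that both of its sides can be inferred by unification.
infix 4 _≈_[mod_]
record _≈_[mod_] (a b m : ℕ) : Set where
  constructor mk≈
  field ≡-mod : a ≡ b [mod m ]
open _≈_[mod_] public

module ModularArithmetic where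
  open import Data.Integer as ℤ using (ℤ; +_)
  import Data.Integer.Properties as ℤ
  import Data.Integer.Divisibility.Signed as ℤ∣
  import Data.Integer.Tactic.RingSolver as ℤSolver

  private
    signed : ∀ {a b m} → a ≈ b [mod m ] → + m ℤ∣.∣ (+ a ℤ.- + b)
    signed a≈b = ℤ∣.∣ᵤ⇒∣ (≡-mod a≈b)

    unsigned : ∀ {a b m} → + m ℤ∣.∣ (+ a ℤ.- + b) → a ≈ b [mod m ]
    unsigned d = mk≈ (ℤ∣.∣⇒∣ᵤ d)

  ≈-refl : ∀ {a m} → a ≈ a [mod m ]
  ≈-refl {a} {m} = unsigned (ℤ∣.divides (+ 0) (trans (ℤ.+-inverseʳ (+ a)) (sym (ℤ.*-zeroˡ (+ m)))))

  ≡⇒≈ : ∀ {a b m} → a ≡ b → a ≈ b [mod m ]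
  ≡⇒≈ refl = ≈-refl

  ≈-sym : ∀ {a b m} → a ≈ b [mod m ] → b ≈ a [mod m ]
  ≈-sym {a} {b} a≈b = unsigned (subst (_ ℤ∣.∣_) (negate (+ a) (+ b)) (ℤ∣.∣m⇒∣-m (signed a≈b)))
    where
    negate : ∀ x y → ℤ.- (x ℤ.- y) ≡ y ℤ.- x
    negate = ℤSolver.solve-∀

  ≈-trans : ∀ {a b c m} → a ≈ b [mod m ] → b ≈ c [mod m ] → a ≈ c [mod m ]
  ≈-trans {a} {b} {c} a≈b b≈c =
    unsigned (subst (_ ℤ∣.∣_) (telescope (+ a) (+ b) (+ c)) (ℤ∣.∣m∣n⇒∣m+n (signed a≈b) (signed b≈c)))
    where
    telescope : ∀ x y z → (x ℤ.- y) ℤ.+ (y ℤ.- z) ≡ x ℤ.- z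
    telescope = ℤSolver.solve-∀

  +-cong-≈ : ∀ {a b c d m} → a ≈ b [mod m ] → c ≈ d [mod m ] → a + c ≈ b + d [mod m ]
  +-cong-≈ {a} {b} {c} {d} a≈b c≈d =
    unsigned (subst (_ ℤ∣.∣_) eq (ℤ∣.∣m∣n⇒∣m+n (signed a≈b) (signed c≈d)))
    where
    interchange : ∀ x y z w → (x ℤ.- y) ℤ.+ (z ℤ.- w) ≡ (x ℤ.+ z) ℤ.- (y ℤ.+ w)
    interchange = ℤSolver.solve-∀
    eq : (+ a ℤ.- + b) ℤ.+ (+ c ℤ.- + d) ≡ + (a + c) ℤ.- + (b + d)
    eq = trans (interchange (+ a) (+ b) (+ c) (+ d)) (sym (cong₂ ℤ._-_ (ℤ.pos-+ a c) (ℤ.pos-+ b d)))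

  *-cong-≈ : ∀ {a b c d m} → a ≈ b [mod m ] → c ≈ d [mod m ] → a * c ≈ b * d [mod m ]
  *-cong-≈ {a} {b} {c} {d} a≈b c≈d =
    unsigned (subst (_ ℤ∣.∣_) eq
      (ℤ∣.∣m∣n⇒∣m+n (ℤ∣.∣n⇒∣m*n (+ a) (signed c≈d)) (ℤ∣.∣m⇒∣m*n (+ d) (signed a≈b))))
    where
    split : ∀ x y z w → x ℤ.* (z ℤ.- w) ℤ.+ (x ℤ.- y) ℤ.* w ≡ x ℤ.* z ℤ.- y ℤ.* w
    split = ℤSolver.solve-∀
    eq : + a ℤ.* (+ c ℤ.- + d) ℤ.+ (+ a ℤ.- + b) ℤ.* + d ≡ + (a * c) ℤ.- + (b * d)
    eq = trans (split (+ a) (+ b) (+ c) (+ d)) (sym (cong₂ ℤ._-_ (ℤ.pos-* a c) (ℤ.pos-* b d)))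

  +-cancelʳ-≈ : ∀ c {a b m} → a + c ≈ b + c [mod m ] → a ≈ b [mod m ]
  +-cancelʳ-≈ c {a} {b} a+c≈b+c = unsigned (subst (_ ℤ∣.∣_) eq (signed a+c≈b+c))
    where
    cancel : ∀ x y z → (x ℤ.+ z) ℤ.- (y ℤ.+ z) ≡ x ℤ.- y
    cancel = ℤSolver.solve-∀
    eq : + (a + c) ℤ.- + (b + c) ≡ + a ℤ.- + b
    eq = trans (cong₂ ℤ._-_ (ℤ.pos-+ a c) (ℤ.pos-+ b c)) (cancel (+ a) (+ b) (+ c))

  +-multiple-≈ : ∀ a k m → a + k * m ≈ a [mod m ]
  +-multiple-≈ a k m = unsigned (ℤ∣.divides (+ k) eq)
    where
    cancel : ∀ x y → (x ℤ.+ y) ℤ.- x ≡ y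
    cancel = ℤSolver.solve-∀
    eq : + (a + k * m) ℤ.- + a ≡ + k ℤ.* + m
    eq = trans (cong (ℤ._- + a) (trans (ℤ.pos-+ a (k * m)) (cong (ℤ._+_ (+ a)) (ℤ.pos-* k m))))
               (cancel (+ a) (+ k ℤ.* + m))

  +-cancelˡ-≈ : ∀ c {a b m} → c + a ≈ c + b [mod m ] → a ≈ b [mod m ]
  +-cancelˡ-≈ c {a} {b} {m} = +-cancelʳ-≈ c ∘ subst₂ (_≈_[mod m ]) (+-comm c a) (+-comm c b)

  ≈⇒∣∸ : ∀ {a b m} → b ≤ a → a ≈ b [mod m ] → m ∣ a ∸ b
  ≈⇒∣∸ {a} {b} {m} b≤a a≈b =
    subst (m ∣_) (trans (cong ℤ.∣_∣ (ℤ.m-n≡m⊖n a b)) (cong ℤ.∣_∣ (ℤ.⊖-≥ b≤a))) (≡-mod a≈b)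

  ≈-injective : ∀ {a b m} → a < m → b < m → a ≈ b [mod m ] → a ≡ b
  ≈-injective {a} {b} {m} a<m b<m a≈b = ℤ.+-injective (ℤ.i-j≡0⇒i≡j (+ a) (+ b) (ℤ.∣i∣≡0⇒i≡0 small))
    where
    ∣<⇒≡0 : ∀ {j} → m ∣ j → j < m → j ≡ 0
    ∣<⇒≡0 {zero}  _   _   = refl
    ∣<⇒≡0 {suc j} m∣j j<m = contradiction (∣⇒≤ m∣j) (<⇒≱ j<m)
    small : ℤ.∣ + a ℤ.- + b ∣ ≡ 0
    small = ∣<⇒≡0 (≡-mod a≈b)
      (subst (_< m) (sym (cong ℤ.∣_∣ (ℤ.m-n≡m⊖n a b))) (≤-<-trans (ℤ.∣m⊝n∣≤m⊔n a b) (⊔-lub a<m b<m)))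

  ≈-weaken : ∀ {a b m d} → d ∣ m → a ≈ b [mod m ] → a ≈ b [mod d ]
  ≈-weaken d∣m a≈b = mk≈ (∣-trans d∣m (≡-mod a≈b))

  ≈-setoid : ℕ → Setoid 0ℓ 0ℓ
  ≈-setoid m = record
    { Carrier       = ℕ
    ; _≈_           = _≈_[mod m ]
    ; isEquivalence = record { refl = ≈-refl ; sym = ≈-sym ; trans = ≈-trans }
    }

  module ≈-Reasoning (m : ℕ) = SetoidReasoning (≈-setoid m)

open ModularArithmetic

%-≈ : ∀ a m .{{_ : NonZero m}} → a % m ≈ a [mod m ]
%-≈ a m = ≈-sym (subst (_≈ a % m [mod m ]) (sym (m≡m%n+[m/n]*n a m)) (+-multiple-≈ (a % m) (a / m) m))

n≈0 : ∀ n → n ≈ 0 [mod n ]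
n≈0 n = subst (_≈ 0 [mod n ]) (*-identityˡ n) (+-multiple-≈ 0 1 n)

≈⇒%-≡ : ∀ {i j} n .{{_ : NonZero n}} → i ≈ j [mod n ] → i % n ≡ j % n
≈⇒%-≡ {i} {j} n i≈j = ≈-injective (m%n<n i n) (m%n<n j n) (≈-trans (%-≈ i n) (≈-trans i≈j (≈-sym (%-≈ j n))))

≈-injective-pos : ∀ {a b m} → 1 ≤ a → 1 ≤ b → a ≤ m → b ≤ m → a ≈ b [mod m ] → a ≡ b
≈-injective-pos {suc a} {suc b} _ _ a<m b<m a≈b = cong suc (≈-injective a<m b<m (+-cancelˡ-≈ 1 a≈b))

-- Powers of two modulo 2^n − 1

2^n≈1 : ∀ n → 2 ^ n ≈ 1 [mod 2 ^ n ∸ 1 ]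
2^n≈1 n = subst (_≈ 1 [mod 2 ^ n ∸ 1 ]) 1+M≡2^n (+-multiple-≈ 1 1 (2 ^ n ∸ 1))
  where
  1+M≡2^n : 1 + 1 * (2 ^ n ∸ 1) ≡ 2 ^ n
  1+M≡2^n = trans (cong suc (*-identityˡ _)) (m+[n∸m]≡n (m^n>0 2 n))

2^-periodic : ∀ n s t → 2 ^ (s + t * n) ≈ 2 ^ s [mod 2 ^ n ∸ 1 ]
2^-periodic n s zero    = ≡⇒≈ (cong (2 ^_) (+-identityʳ s))
2^-periodic n s (suc t) = begin
  2 ^ (s + (n + t * n))     ≡⟨ cong (2 ^_) (x+[y+z]≡y+[x+z] s n (t * n)) ⟩
  2 ^ (n + (s + t * n))     ≡⟨ ^-distribˡ-+-* 2 n (s + t * n) ⟩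
  2 ^ n * 2 ^ (s + t * n)   ≈⟨ *-cong-≈ (2^n≈1 n) (2^-periodic n s t) ⟩
  1 * 2 ^ s                 ≡⟨ *-identityˡ (2 ^ s) ⟩
  2 ^ s                     ∎
  where
  open ≈-Reasoning (2 ^ n ∸ 1)
  x+[y+z]≡y+[x+z] : ∀ x y z → x + (y + z) ≡ y + (x + z)
  x+[y+z]≡y+[x+z] = solve-∀

2^-≈-% : ∀ n .{{_ : NonZero n}} k → 2 ^ k ≈ 2 ^ (k % n) [mod 2 ^ n ∸ 1 ]
2^-≈-% n k = begin
  2 ^ k                       ≡⟨ cong (2 ^_) (m≡m%n+[m/n]*n k n) ⟩
  2 ^ (k % n + (k / n) * n)   ≈⟨ 2^-periodic n (k % n) (k / n) ⟩
  2 ^ (k % n)                 ∎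
  where open ≈-Reasoning (2 ^ n ∸ 1)

2^-cong : ∀ {i j} n .{{_ : NonZero n}} → i ≈ j [mod n ] → 2 ^ i ≈ 2 ^ j [mod 2 ^ n ∸ 1 ]
2^-cong {i} {j} n i≈j = begin
  2 ^ i         ≈⟨ 2^-≈-% n i ⟩
  2 ^ (i % n)   ≡⟨ cong (2 ^_) (≈⇒%-≡ n i≈j) ⟩
  2 ^ (j % n)   ≈⟨ 2^-≈-% n j ⟨
  2 ^ j         ∎
  where open ≈-Reasoning (2 ^ n ∸ 1)

2^n≡2^[n∸1]*2 : ∀ n .{{_ : NonZero n}} → 2 ^ n ≡ 2 ^ (n ∸ 1) * 2
2^n≡2^[n∸1]*2 (suc m) = *-comm 2 (2 ^ m)

-- Sums of distinct powers of two

sum2^ : List ℕ → ℕ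
sum2^ []       = 0
sum2^ (x ∷ xs) = 2 ^ x + sum2^ xs

zeros : List ℕ → ℕ
zeros []           = 0
zeros (zero  ∷ xs) = suc (zeros xs)
zeros (suc _ ∷ xs) = zeros xs

shiftDown : List ℕ → List ℕ
shiftDown []           = []
shiftDown (zero  ∷ xs) = shiftDown xs
shiftDown (suc x ∷ xs) = x ∷ shiftDown xs

sum2^-halve : ∀ xs → sum2^ xs ≡ zeros xs + sum2^ (shiftDown xs) * 2
sum2^-halve []           = refl
sum2^-halve (zero  ∷ xs) = cong suc (sum2^-halve xs)
sum2^-halve (suc x ∷ xs) = trans (cong (2 ^ suc x +_) (sum2^-halve xs)) (regroup (2 ^ x) (zeros xs) (sum2^ (shiftDown xs)))
  where
  regroup : ∀ p z s → 2 * p + (z + s * 2) ≡ z + (p + s) * 2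
  regroup = solve-∀

zeros-all≢0 : ∀ {xs} → All (0 ≢_) xs → zeros xs ≡ 0
zeros-all≢0 {[]}         []          = refl
zeros-all≢0 {zero  ∷ xs} (0≢0 ∷ _)   = contradiction refl 0≢0
zeros-all≢0 {suc _ ∷ xs} (_ ∷ 0≢xs) = zeros-all≢0 0≢xs

zeros-unique : ∀ {xs} → Unique xs → zeros xs < 2
zeros-unique {[]}         []          = s≤s z≤n
zeros-unique {zero  ∷ xs} (0≢xs ∷ _) = s≤s (s≤s (≤-reflexive (zeros-all≢0 0≢xs)))
zeros-unique {suc _ ∷ xs} (_ ∷ u)    = zeros-unique u

0∈⇒zeros>0 : ∀ {xs} → 0 ∈ xs → 1 ≤ zeros xs
0∈⇒zeros>0 {zero  ∷ xs} _         = s≤s z≤n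
0∈⇒zeros>0 {suc _ ∷ xs} (there m) = 0∈⇒zeros>0 m

zeros>0⇒0∈ : ∀ xs → 1 ≤ zeros xs → 0 ∈ xs
zeros>0⇒0∈ (zero  ∷ xs) _   = here refl
zeros>0⇒0∈ (suc _ ∷ xs) z>0 = there (zeros>0⇒0∈ xs z>0)

∈-shiftDown⁺ : ∀ {k} xs → suc k ∈ xs → k ∈ shiftDown xs
∈-shiftDown⁺ (zero  ∷ xs) (there m)    = ∈-shiftDown⁺ xs m
∈-shiftDown⁺ (suc _ ∷ xs) (here refl)  = here refl
∈-shiftDown⁺ (suc _ ∷ xs) (there m)    = there (∈-shiftDown⁺ xs m)

∈-shiftDown⁻ : ∀ {k} xs → k ∈ shiftDown xs → suc k ∈ xs
∈-shiftDown⁻ (zero  ∷ xs) m           = there (∈-shiftDown⁻ xs m)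
∈-shiftDown⁻ (suc _ ∷ xs) (here refl) = here refl
∈-shiftDown⁻ (suc _ ∷ xs) (there m)   = there (∈-shiftDown⁻ xs m)

shiftDown-all≢ : ∀ {x} xs → All (suc x ≢_) xs → All (x ≢_) (shiftDown xs)
shiftDown-all≢ []           []          = []
shiftDown-all≢ (zero  ∷ xs) (_ ∷ ps)    = shiftDown-all≢ xs ps
shiftDown-all≢ (suc _ ∷ xs) (p ∷ ps)    = (λ e → p (cong suc e)) ∷ shiftDown-all≢ xs ps

shiftDown-unique : ∀ {xs} → Unique xs → Unique (shiftDown xs)
shiftDown-unique {[]}         []       = []
shiftDown-unique {zero  ∷ xs} (_ ∷ u)  = shiftDown-unique u
shiftDown-unique {suc _ ∷ xs} (p ∷ u)  = shiftDown-all≢ xs p ∷ shiftDown-unique u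

shiftDown-< : ∀ {n xs} → All (_< suc n) xs → All (_< n) (shiftDown xs)
shiftDown-< {xs = []}         []              = []
shiftDown-< {xs = zero  ∷ xs} (_ ∷ ps)        = shiftDown-< ps
shiftDown-< {xs = suc _ ∷ xs} (s≤s p ∷ ps)    = p ∷ shiftDown-< ps

sum2^<2^ : ∀ n {xs} → Unique xs → All (_< n) xs → sum2^ xs < 2 ^ n
sum2^<2^ zero    {[]}    _ _        = s≤s z≤n
sum2^<2^ zero    {_ ∷ _} _ (() ∷ _)
sum2^<2^ (suc n) {xs}    u bounded  = begin-strict
  sum2^ xs                        ≡⟨ sum2^-halve xs ⟩
  zeros xs + s * 2                <⟨ s≤s (+-monoˡ-≤ (s * 2) (≤-pred (zeros-unique u))) ⟩
  suc s * 2                       ≤⟨ *-monoˡ-≤ 2 (sum2^<2^ n (shiftDown-unique u) (shiftDown-< bounded)) ⟩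
  2 ^ n * 2                       ≡⟨ *-comm (2 ^ n) 2 ⟩
  2 ^ suc n                       ∎
  where
  open ≤-Reasoning
  s : ℕ
  s = sum2^ (shiftDown xs)

sum2^-≡-halves : ∀ {xs ys} → Unique xs → Unique ys → sum2^ xs ≡ sum2^ ys →
                 zeros xs ≡ zeros ys × sum2^ (shiftDown xs) ≡ sum2^ (shiftDown ys)
sum2^-≡-halves {xs} {ys} uxs uys eq = parity-unique (zeros-unique uxs) (zeros-unique uys)
  (trans (sym (sum2^-halve xs)) (trans eq (sum2^-halve ys)))

sum2^-injective : ∀ {xs ys} → Unique xs → Unique ys → sum2^ xs ≡ sum2^ ys → xs ⊆ ys
sum2^-injective {xs} {ys} uxs uys eq {zero} 0∈xs =
  zeros>0⇒0∈ ys (subst (1 ≤_) (proj₁ (sum2^-≡-halves uxs uys eq)) (0∈⇒zeros>0 0∈xs))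
sum2^-injective {xs} {ys} uxs uys eq {suc k} k+1∈xs =
  ∈-shiftDown⁻ ys (sum2^-injective (shiftDown-unique uxs) (shiftDown-unique uys)
                     (proj₂ (sum2^-≡-halves uxs uys eq)) (∈-shiftDown⁺ xs k+1∈xs))

pair-members : ∀ {x y p q : ℕ} → x ≢ y → x ∈ (p ∷ q ∷ []) → y ∈ (p ∷ q ∷ []) →
               (x ≡ p × y ≡ q) ⊎ (x ≡ q × y ≡ p)
pair-members x≢y (here x≡p)         (here y≡p)         = contradiction (trans x≡p (sym y≡p)) x≢y
pair-members x≢y (here x≡p)         (there (here y≡q)) = inj₁ (x≡p , y≡q)
pair-members x≢y (there (here x≡q)) (here y≡p)         = inj₂ (x≡q , y≡p)
pair-members x≢y (there (here x≡q)) (there (here y≡q)) = contradiction (trans x≡q (sym y≡q)) x≢y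

unique≥3⊈pair : ∀ {x y z ws p q} → Unique (x ∷ y ∷ z ∷ ws) → ¬ (x ∷ y ∷ z ∷ ws) ⊆ (p ∷ q ∷ [])
unique≥3⊈pair ((x≢y ∷ x≢z ∷ _) ∷ (y≢z ∷ _) ∷ _) sub
  with pair-members x≢y (sub (here refl)) (sub (there (here refl))) | sub (there (there (here refl)))
... | inj₁ (x≡p , _) | here z≡p         = x≢z (trans x≡p (sym z≡p))
... | inj₁ (_ , y≡q) | there (here z≡q) = y≢z (trans y≡q (sym z≡q))
... | inj₂ (_ , y≡p) | here z≡p         = y≢z (trans y≡p (sym z≡p))
... | inj₂ (x≡q , _) | there (here z≡q) = x≢z (trans x≡q (sym z≡q))

sum2^-≈⇒⊆ : ∀ n {x xs y ys} → Unique (x ∷ xs) → Unique (y ∷ ys) → All (_< n) (x ∷ xs) → All (_< n) (y ∷ ys) →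
            sum2^ (x ∷ xs) ≈ sum2^ (y ∷ ys) [mod 2 ^ n ∸ 1 ] → (x ∷ xs) ⊆ (y ∷ ys)
sum2^-≈⇒⊆ n {x} {xs} {y} {ys} uxs uys bxs bys sums≈ =
  sum2^-injective uxs uys (≈-injective-pos (positive x xs) (positive y ys)
                             (∸-monoˡ-≤ 1 (sum2^<2^ n uxs bxs)) (∸-monoˡ-≤ 1 (sum2^<2^ n uys bys)) sums≈)
  where
  positive : ∀ z zs → 1 ≤ sum2^ (z ∷ zs)
  positive z zs = ≤-trans (m^n>0 2 z) (m≤m+n _ _)

sum2^-≈-pair : ∀ n {x y p q} → x ≢ y → p ≢ q → x < n → y < n → p < n → q < n →
               sum2^ (x ∷ y ∷ []) ≈ sum2^ (p ∷ q ∷ []) [mod 2 ^ n ∸ 1 ] → (x ≡ p × y ≡ q) ⊎ (x ≡ q × y ≡ p)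
sum2^-≈-pair n {x} {y} {p} {q} x≢y p≢q x<n y<n p<n q<n sums≈ = pair-members x≢y (sub (here refl)) (sub (there (here refl)))
  where
  sub : (x ∷ y ∷ []) ⊆ (p ∷ q ∷ [])
  sub = sum2^-≈⇒⊆ n ((x≢y ∷ []) ∷ [] ∷ []) ((p≢q ∷ []) ∷ [] ∷ []) (x<n ∷ y<n ∷ []) (p<n ∷ q<n ∷ []) sums≈

sum2^-≉-pair : ∀ n {x y z ws p q} → Unique (x ∷ y ∷ z ∷ ws) → All (_< n) (x ∷ y ∷ z ∷ ws) →
               p ≢ q → p < n → q < n →
               ¬ sum2^ (x ∷ y ∷ z ∷ ws) ≈ sum2^ (p ∷ q ∷ []) [mod 2 ^ n ∸ 1 ]
sum2^-≉-pair n u bounded p≢q p<n q<n sums≈ =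
  unique≥3⊈pair u (sum2^-≈⇒⊆ n u ((p≢q ∷ []) ∷ [] ∷ []) bounded (p<n ∷ q<n ∷ []) sums≈)

sum2^-merge : ∀ d a → sum2^ (d ∷ a ∷ 0 ∷ d ∷ []) ≡ sum2^ (suc d ∷ a ∷ 0 ∷ [])
sum2^-merge d a = merge (2 ^ d) (2 ^ a)
  where
  merge : ∀ x y → x + (y + (1 + (x + 0))) ≡ 2 * x + (y + (1 + 0))
  merge = solve-∀

2^[2r]≡2^r*2^r : ∀ r → 2 ^ (2 * r) ≡ 2 ^ r * 2 ^ r
2^[2r]≡2^r*2^r r = trans (cong (λ e → 2 ^ (r + e)) (+-identityʳ r)) (^-distribˡ-+-* 2 r r)

2^[3r]≡2^r*[2^r*2^r] : ∀ r → 2 ^ (3 * r) ≡ 2 ^ r * (2 ^ r * 2 ^ r)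
2^[3r]≡2^r*[2^r*2^r] r = trans (^-distribˡ-+-* 2 r (2 * r)) (cong (2 ^ r *_) (2^[2r]≡2^r*2^r r))

K+2^r≡2^r*2^r+1 : ∀ r → K r + 2 ^ r ≡ 2 ^ r * 2 ^ r + 1
K+2^r≡2^r*2^r+1 r = begin
  (A ∸ u + 1) + u    ≡⟨ swap (A ∸ u) 1 u ⟩
  (A ∸ u + u) + 1    ≡⟨ cong (_+ 1) (m∸n+n≡m (^-monoʳ-≤ 2 (m≤m+n r (r + 0)))) ⟩
  A + 1              ≡⟨ cong (_+ 1) (2^[2r]≡2^r*2^r r) ⟩
  u * u + 1          ∎
  where
  open ≡-Reasoning
  u A : ℕ
  u = 2 ^ r
  A = 2 ^ (2 * r)
  swap : ∀ x y z → (x + y) + z ≡ (x + z) + y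
  swap = solve-∀

K-factor : ∀ r → K r * (2 ^ r + 1) ≡ 2 ^ (3 * r) + 1
K-factor r = +-cancelʳ-≡ (u * u + u) _ _ (begin
  K r * (u + 1) + (u * u + u)        ≡⟨ distrib (K r) u ⟩
  (K r + u) * (u + 1)                ≡⟨ cong (_* (u + 1)) (K+2^r≡2^r*2^r+1 r) ⟩
  (u * u + 1) * (u + 1)              ≡⟨ expand u ⟩
  u * (u * u) + 1 + (u * u + u)      ≡⟨ cong (λ v → v + 1 + (u * u + u)) (sym (2^[3r]≡2^r*[2^r*2^r] r)) ⟩
  2 ^ (3 * r) + 1 + (u * u + u)      ∎)
  where
  open ≡-Reasoning
  u : ℕ
  u = 2 ^ r
  distrib : ∀ k u → k * (u + 1) + (u * u + u) ≡ (k + u) * (u + 1)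
  distrib = solve-∀
  expand : ∀ u → (u * u + 1) * (u + 1) ≡ u * (u * u) + 1 + (u * u + u)
  expand = solve-∀

K-cong : ∀ r {u m} → 2 ^ r ≈ u [mod m ] → K r + u ≈ u * u + 1 [mod m ]
K-cong r {u} {m} 2^r≈u = begin
  K r + u            ≈⟨ +-cong-≈ (≈-refl {K r}) (≈-sym 2^r≈u) ⟩
  K r + 2 ^ r        ≡⟨ K+2^r≡2^r*2^r+1 r ⟩
  2 ^ r * 2 ^ r + 1  ≈⟨ +-cong-≈ (*-cong-≈ 2^r≈u 2^r≈u) ≈-refl ⟩
  u * u + 1          ∎
  where open ≈-Reasoning m

d+d≈0⇒d+d≡n : ∀ {n d} → 1 ≤ d → d < n → d + d ≈ 0 [mod n ] → d + d ≡ n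
d+d≈0⇒d+d≡n {n} {d} 1≤d d<n d+d≈0 = trans (cong (_+ d) d≡n∸d) (m∸n+n≡m (<⇒≤ d<n))
  where
  open ≈-Reasoning n
  d≡n∸d : d ≡ n ∸ d
  d≡n∸d = ≈-injective d<n (∸-monoʳ-< 1≤d (<⇒≤ d<n)) (+-cancelʳ-≈ d (begin
    d + d          ≈⟨ d+d≈0 ⟩
    0              ≈⟨ n≈0 n ⟨
    n              ≡⟨ m∸n+n≡m (<⇒≤ d<n) ⟨
    (n ∸ d) + d    ∎))

infix 4 _≈_±_[mod_]
_≈_±_[mod_] : ℕ → ℕ → ℕ → ℕ → Set
x ≈ y ± c [mod m ] = x ≈ y + c [mod m ] ⊎ y ≈ x + c [mod m ]

≈-±-transˡ : ∀ {x x' y c m} → x ≈ x' [mod m ] → x' ≈ y ± c [mod m ] → x ≈ y ± c [mod m ]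
≈-±-transˡ x≈x' (inj₁ x'≈y+c) = inj₁ (≈-trans x≈x' x'≈y+c)
≈-±-transˡ x≈x' (inj₂ y≈x'+c) = inj₂ (≈-trans y≈x'+c (+-cong-≈ (≈-sym x≈x') ≈-refl))

≈-±-difference : ∀ {e e' r c m} → e' ≈ e + r [mod m ] → e' ≈ e ± c [mod m ] → r ≈ 0 ± c [mod m ]
≈-±-difference {e} {e'} {r} {c} {m} e'≈e+r (inj₁ e'≈e+c) = inj₁ (+-cancelˡ-≈ e (≈-trans (≈-sym e'≈e+r) e'≈e+c))
≈-±-difference {e} {e'} {r} {c} {m} e'≈e+r (inj₂ e≈e'+c) = inj₂ (+-cancelˡ-≈ e (begin
  e + 0          ≡⟨ +-identityʳ e ⟩
  e              ≈⟨ e≈e'+c ⟩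
  e' + c         ≈⟨ +-cong-≈ e'≈e+r ≈-refl ⟩
  e + r + c      ≡⟨ +-assoc e r c ⟩
  e + (r + c)    ∎))
  where open ≈-Reasoning m

0≈r+3⇒0≈3r+9 : ∀ {n r} → 0 ≈ r + 3 [mod n ] → 0 ≈ 3 * r + 9 [mod n ]
0≈r+3⇒0≈3r+9 {r = r} 0≈r+3 = ≈-trans (*-cong-≈ (≈-refl {3}) 0≈r+3) (≡⇒≈ (*-distribˡ-+ 3 r 3))

±3∧3×±1⇒∣8⊎∣10 : ∀ {n r} → r ≈ 0 ± 3 [mod n ] → 3 * r ≈ 0 ± 1 [mod n ] → n ∣ 8 ⊎ n ∣ 10
±3∧3×±1⇒∣8⊎∣10 {n} {r} (inj₁ r≈3) (inj₁ 3r≈1) =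
  inj₁ (≈⇒∣∸ (s≤s z≤n) (≈-trans (≈-sym (*-cong-≈ (≈-refl {3}) r≈3)) 3r≈1))
±3∧3×±1⇒∣8⊎∣10 {n} {r} (inj₁ r≈3) (inj₂ 0≈3r+1) =
  inj₂ (≈⇒∣∸ z≤n (≈-trans (+-cong-≈ (≈-sym (*-cong-≈ (≈-refl {3}) r≈3)) (≈-refl {1})) (≈-sym 0≈3r+1)))
±3∧3×±1⇒∣8⊎∣10 {n} {r} (inj₂ 0≈r+3) (inj₁ 3r≈1) =
  inj₂ (≈⇒∣∸ z≤n (≈-sym (≈-trans (0≈r+3⇒0≈3r+9 0≈r+3) (+-cong-≈ 3r≈1 ≈-refl))))
±3∧3×±1⇒∣8⊎∣10 {n} {r} (inj₂ 0≈r+3) (inj₂ 0≈3r+1) =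
  inj₁ (≈⇒∣∸ (s≤s z≤n) (+-cancelˡ-≈ (3 * r) (≈-trans (≈-sym (0≈r+3⇒0≈3r+9 0≈r+3)) 0≈3r+1)))

∣8⊎∣10⇒even : ∀ k → 6 + k ∣ 8 ⊎ 6 + k ∣ 10 → 2 ∣ 6 + k
∣8⊎∣10⇒even 0 _ = divides 3 refl
∣8⊎∣10⇒even 1 (inj₁ 7∣8)  with () ← n∣m⇒m%n≡0 8 7 7∣8
∣8⊎∣10⇒even 1 (inj₂ 7∣10) with () ← n∣m⇒m%n≡0 10 7 7∣10
∣8⊎∣10⇒even 2 _ = divides 4 refl
∣8⊎∣10⇒even 3 (inj₁ 9∣8)  with () ← n∣m⇒m%n≡0 8 9 9∣8
∣8⊎∣10⇒even 3 (inj₂ 9∣10) with () ← n∣m⇒m%n≡0 10 9 9∣10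
∣8⊎∣10⇒even 4 _ = divides 5 refl
∣8⊎∣10⇒even (suc (suc (suc (suc (suc k))))) (inj₁ ∣8)  = contradiction ∣8 (>⇒∤ (m≤m+n 9 (2 + k)))
∣8⊎∣10⇒even (suc (suc (suc (suc (suc k))))) (inj₂ ∣10) = contradiction ∣10 (>⇒∤ (m≤m+n 11 k))

≈0±3⇒odd : ∀ {n r} → 2 ∣ n → r ≈ 0 ± 3 [mod n ] → r ≈ 1 [mod 2 ]
≈0±3⇒odd 2∣n (inj₁ r≈3)   = ≈-trans (≈-weaken 2∣n r≈3) (+-multiple-≈ 1 1 2)
≈0±3⇒odd 2∣n (inj₂ 0≈r+3) = +-cancelʳ-≈ 3 (≈-trans (≈-sym (≈-weaken 2∣n 0≈r+3)) (≈-sym (+-multiple-≈ 0 2 2)))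

odd⇒3∣K : ∀ {r} → r ≈ 1 [mod 2 ] → 3 ∣ K r
odd⇒3∣K {r} r≈1 = ≈⇒∣∸ z≤n (≈-trans (+-cancelʳ-≈ 2 {K r} {3} (K-cong r 2^r≈2)) (n≈0 3))
  where
  r≡1+2q : r ≡ 1 + (r / 2) * 2
  r≡1+2q = trans (m≡m%n+[m/n]*n r 2) (cong (_+ (r / 2) * 2) (≈⇒%-≡ 2 r≈1))
  2^r≈2 : 2 ^ r ≈ 2 [mod 3 ]
  2^r≈2 = subst (λ e → 2 ^ e ≈ 2 [mod 3 ]) (sym r≡1+2q) (2^-periodic 2 1 (r / 2))

even⇒3∣2^n∸1 : ∀ {n} → 2 ∣ n → 3 ∣ 2 ^ n ∸ 1
even⇒3∣2^n∸1 {n} (divides q refl) = ≈⇒∣∸ (m^n>0 2 (q * 2)) (2^-periodic 2 0 q)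

±3∧3×±1⇒¬coprime : ∀ k {r} → Coprime (K r) (2 ^ (6 + k) ∸ 1) →
                         r ≈ 0 ± 3 [mod 6 + k ] → 3 * r ≈ 0 ± 1 [mod 6 + k ] → ⊥
±3∧3×±1⇒¬coprime k coprime r≈±3 3r≈±1 =
  contradiction (coprime (odd⇒3∣K (≈0±3⇒odd 2∣n r≈±3) , even⇒3∣2^n∸1 2∣n)) (λ ())
  where
  2∣n : 2 ∣ 6 + k
  2∣n = ∣8⊎∣10⇒even k (±3∧3×±1⇒∣8⊎∣10 r≈±3 3r≈±1)

-- A sum of four powers 2^a + 2^a' + 2^0 + 2^d with a' ≡ a + d can only reduce to two distinct
-- powers through the collisions a = d ∈ {1, n − 1} or a + d = n with 1 ∈ {a, d}; in each of them
-- a ≡ ±1 and the two surviving exponents differ by 3.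
module Classification (k : ℕ) where

  -- n is written 4 + k so that n − 1 and n − 2 are 3 + k and 2 + k by computation.
  n : ℕ
  n = 4 + k

  private
    0<n : 0 < n
    0<n = s≤s z≤n
    1<n : 1 < n
    1<n = s≤s (s≤s z≤n)
    2<n : 2 < n
    2<n = s≤s (s≤s (s≤s z≤n))
    3<n : 3 < n
    3<n = m≤m+n 4 k
    n∸2<n : 2 + k < n
    n∸2<n = n≤1+n (3 + k)
    n∸1<n : 3 + k < n
    n∸1<n = ≤-refl
    n∸1+3≡2+n : 3 + k + 3 ≡ 2 + 1 * n
    n∸1+3≡2+n = lemma k
      where
      lemma : ∀ k → 3 + k + 3 ≡ 2 + 1 * (4 + k)
      lemma = solve-∀
    n∸2+3≡1+n : 2 + k + 3 ≡ 1 + 1 * n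
    n∸2+3≡1+n = lemma k
      where
      lemma : ∀ k → 2 + k + 3 ≡ 1 + 1 * (4 + k)
      lemma = solve-∀
    n∸1+1≈0 : 3 + k + 1 ≈ 0 [mod n ]
    n∸1+1≈0 = subst (_≈ 0 [mod n ]) (+-comm 1 (3 + k)) (n≈0 n)
    wraps-by-3 : ∀ p {q} → p + 3 ≡ q + 1 * n → q ≈ p + 3 [mod n ]
    wraps-by-3 p {q} eq = ≈-sym (subst (_≈ q [mod n ]) (sym eq) (+-multiple-≈ q 1 n))
    x+4≡4+x : ∀ x → x + (4 + 0) ≡ 4 + (x + 0)
    x+4≡4+x = solve-∀
    n∸1+n∸1≈n∸2 : (3 + k) + (3 + k) ≈ 2 + k [mod n ]
    n∸1+n∸1≈n∸2 = subst (_≈ 2 + k [mod n ]) (double k) (+-multiple-≈ (2 + k) 1 n)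
      where
      double : ∀ k → 2 + k + 1 * (4 + k) ≡ (3 + k) + (3 + k)
      double = solve-∀

  module _ {e e'} (e<n : e < n) (e'<n : e' < n) (e'≢e : e' ≢ e) where

    pair-shifted : ∀ {p q} → p ≢ q → p < n → q < n → q ≈ p + 3 [mod n ] →
                   sum2^ (p ∷ q ∷ []) ≈ sum2^ (e' ∷ e ∷ []) [mod 2 ^ n ∸ 1 ] →
                   e' ≈ e ± 3 [mod n ]
    pair-shifted p≢q p<n q<n q≈p+3 sums≈ with sum2^-≈-pair n p≢q e'≢e p<n q<n e'<n e<n sums≈
    ... | inj₁ (refl , refl) = inj₂ q≈p+3
    ... | inj₂ (refl , refl) = inj₁ q≈p+3

    no-three : ∀ {x y z ws} → Unique (x ∷ y ∷ z ∷ ws) → All (_< n) (x ∷ y ∷ z ∷ ws) →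
               ¬ sum2^ (x ∷ y ∷ z ∷ ws) ≈ sum2^ (e' ∷ e ∷ []) [mod 2 ^ n ∸ 1 ]
    no-three u bounded = sum2^-≉-pair n u bounded e'≢e e'<n e<n

    top-doubled : sum2^ (3 + k ∷ 2 + k ∷ 0 ∷ 3 + k ∷ []) ≈ sum2^ (e' ∷ e ∷ []) [mod 2 ^ n ∸ 1 ] →
                  e' ≈ e ± 3 [mod n ]
    top-doubled sums≈ = pair-shifted {2 + k} {1} (λ ()) n∸2<n 1<n (wraps-by-3 (2 + k) n∸2+3≡1+n) (begin
      2 ^ (2 + k) + (2 + 0)                   ≡⟨ carry (2 ^ (2 + k)) ⟩
      1 + (2 ^ (2 + k) + (1 + 0))             ≈⟨ +-cong-≈ (≈-sym (2^n≈1 n)) ≈-refl ⟩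
      sum2^ (n ∷ 2 + k ∷ 0 ∷ [])              ≡⟨ sum2^-merge (3 + k) (2 + k) ⟨
      sum2^ (3 + k ∷ 2 + k ∷ 0 ∷ 3 + k ∷ [])  ≈⟨ sums≈ ⟩
      sum2^ (e' ∷ e ∷ [])                     ∎)
      where
      open ≈-Reasoning (2 ^ n ∸ 1)
      carry : ∀ y → y + (2 + 0) ≡ 1 + (y + (1 + 0))
      carry = solve-∀

    doubled-case : ∀ {d a'} → d < n → a' < n → 1 ≤ d → d + d ≢ n → a' ≈ d + d [mod n ] →
                   sum2^ (d ∷ a' ∷ 0 ∷ d ∷ []) ≈ sum2^ (e' ∷ e ∷ []) [mod 2 ^ n ∸ 1 ] →
                   d ≈ 0 ± 1 [mod n ] × e' ≈ e ± 3 [mod n ]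
    doubled-case {d} {a'} d<n a'<n 1≤d 2d≢n a'≈2d sums≈ with a' ≟ 0 | suc d ≟ n | suc d ≟ a'
    ... | yes refl | _ | _ = contradiction (d+d≈0⇒d+d≡n 1≤d d<n (≈-sym a'≈2d)) 2d≢n
    ... | no a'≢0 | yes refl | _ =
      inj₂ (≈-sym n∸1+1≈0) ,
      top-doubled (subst (λ a' → sum2^ (3 + k ∷ a' ∷ 0 ∷ 3 + k ∷ []) ≈ _ [mod _ ]) a'≡n∸2 sums≈)
      where
      a'≡n∸2 : a' ≡ 2 + k
      a'≡n∸2 = ≈-injective a'<n n∸2<n (≈-trans a'≈2d n∸1+n∸1≈n∸2)
    ... | no a'≢0 | no d+1≢n | yes refl
      with refl ← ≈-injective 1<n d<n (+-cancelʳ-≈ d a'≈2d)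
      = inj₁ ≈-refl , pair-shifted {0} {3} (λ ()) 0<n 3<n ≈-refl sums≈
    ... | no a'≢0 | no d+1≢n | no d+1≢a' =
      contradiction (≈-trans (≡⇒≈ (sym (sum2^-merge d a'))) sums≈)
        (no-three ((d+1≢a' ∷ (λ ()) ∷ []) ∷ (a'≢0 ∷ []) ∷ [] ∷ []) (≤∧≢⇒< d<n d+1≢n ∷ a'<n ∷ 0<n ∷ []))

    wrapped-pair : sum2^ (3 + k ∷ 2 ∷ []) ≈ sum2^ (e' ∷ e ∷ []) [mod 2 ^ n ∸ 1 ] → e' ≈ e ± 3 [mod n ]
    wrapped-pair = pair-shifted {3 + k} {2} (λ ()) n∸1<n 2<n (wraps-by-3 (3 + k) n∸1+3≡2+n)

    wrap-case : ∀ {a d} → a < n → d < n → a ≢ d → 0 ≈ a + d [mod n ] →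
                sum2^ (a ∷ 0 ∷ 0 ∷ d ∷ []) ≈ sum2^ (e' ∷ e ∷ []) [mod 2 ^ n ∸ 1 ] →
                a ≈ 0 ± 1 [mod n ] × e' ≈ e ± 3 [mod n ]
    wrap-case {a} {d} a<n d<n a≢d 0≈a+d sums≈ with d ≟ 1 | a ≟ 1
    ... | yes refl | _ =
      subst (_≈ 0 ± 1 [mod n ]) (sym a≡n∸1) (inj₂ (≈-sym n∸1+1≈0)) ,
      wrapped-pair (subst (λ a → sum2^ (a ∷ 0 ∷ 0 ∷ 1 ∷ []) ≈ _ [mod _ ]) a≡n∸1 sums≈)
      where
      a≡n∸1 : a ≡ 3 + k
      a≡n∸1 = ≈-injective a<n n∸1<n (+-cancelʳ-≈ 1 {a} {3 + k} (≈-trans (≈-sym 0≈a+d) (≈-sym n∸1+1≈0)))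
    ... | no d≢1 | yes refl =
      inj₁ ≈-refl ,
      wrapped-pair (≈-trans (≡⇒≈ (x+4≡4+x (2 ^ (3 + k))))
                            (subst (λ d → sum2^ (1 ∷ 0 ∷ 0 ∷ d ∷ []) ≈ _ [mod _ ]) d≡n∸1 sums≈))
      where
      d≡n∸1 : d ≡ 3 + k
      d≡n∸1 = ≈-injective d<n n∸1<n (+-cancelˡ-≈ 1 {d} {3 + k} (≈-trans (≈-sym 0≈a+d) (≈-sym (n≈0 n))))
    ... | no d≢1 | no a≢1 =
      contradiction sums≈
        (no-three {a} {1} {d} {[]} ((a≢1 ∷ a≢d ∷ []) ∷ ((d≢1 ∘ sym) ∷ []) ∷ [] ∷ []) (a<n ∷ 1<n ∷ d<n ∷ []))

    distinct-case : ∀ {a a' d} → a < n → a' < n → d < n → 1 ≤ d → a ≢ 0 → a' ≢ 0 → a ≢ d →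
                    a' ≈ a + d [mod n ] →
                    ¬ sum2^ (a ∷ a' ∷ 0 ∷ d ∷ []) ≈ sum2^ (e' ∷ e ∷ []) [mod 2 ^ n ∸ 1 ]
    distinct-case {a} {a'} {d} a<n a'<n d<n 1≤d a≢0 a'≢0 a≢d a'≈a+d =
      no-three ((a≢a' ∷ a≢0 ∷ a≢d ∷ []) ∷ (a'≢0 ∷ a'≢d ∷ []) ∷ ((<⇒≢ 1≤d) ∷ []) ∷ [] ∷ [])
               (a<n ∷ a'<n ∷ 0<n ∷ d<n ∷ [])
      where
      a≢a' : a ≢ a'
      a≢a' refl = <⇒≢ 1≤d (≈-injective 0<n d<n (+-cancelˡ-≈ a (≈-trans (≡⇒≈ (+-identityʳ a)) a'≈a+d)))
      a'≢d : a' ≢ d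
      a'≢d refl = a≢0 (sym (≈-injective 0<n a<n (+-cancelʳ-≈ d a'≈a+d)))

    classify : ∀ {a a' d} → a < n → a' < n → d < n → 1 ≤ d → a ≢ 0 → d + d ≢ n → a' ≈ a + d [mod n ] →
               sum2^ (a ∷ a' ∷ 0 ∷ d ∷ []) ≈ sum2^ (e' ∷ e ∷ []) [mod 2 ^ n ∸ 1 ] →
               a ≈ 0 ± 1 [mod n ] × e' ≈ e ± 3 [mod n ]
    classify {a} {a'} {d} a<n a'<n d<n 1≤d a≢0 2d≢n a'≈a+d sums≈ with a ≟ d | a' ≟ 0
    ... | yes refl | _        = doubled-case d<n a'<n 1≤d 2d≢n a'≈a+d sums≈
    ... | no a≢d   | yes refl = wrap-case a<n d<n a≢d a'≈a+d sums≈
    ... | no a≢d   | no a'≢0  = contradiction sums≈ (distinct-case a<n a'<n d<n 1≤d a≢0 a'≢0 a≢d a'≈a+d)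

-- Weight two forces n ∣ 3r

n∣r⇒x≈1 : ∀ {n r x} → n ∣ r → K r * x ≈ 1 [mod 2 ^ n ∸ 1 ] → x ≈ 1 [mod 2 ^ n ∸ 1 ]
n∣r⇒x≈1 {n} {_} {x} (divides q refl) Kx≈1 = begin
  x              ≡⟨ *-identityˡ x ⟨
  1 * x          ≈⟨ *-cong-≈ (≈-sym K≈1) (≈-refl {x}) ⟩
  K (q * n) * x  ≈⟨ Kx≈1 ⟩
  1              ∎
  where
  open ≈-Reasoning (2 ^ n ∸ 1)
  K≈1 : K (q * n) ≈ 1 [mod 2 ^ n ∸ 1 ]
  K≈1 = +-cancelʳ-≈ 1 {K (q * n)} {1} (K-cong (q * n) (2^-periodic n 0 q))

v*v∸1≡[v∸1]*[v+1] : ∀ v → v * v ∸ 1 ≡ (v ∸ 1) * (v + 1)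
v*v∸1≡[v∸1]*[v+1] zero    = refl
v*v∸1≡[v∸1]*[v+1] (suc w) = expand w
  where
  expand : ∀ w → w + w * suc w ≡ w * (suc w + 1)
  expand = solve-∀

2^d+1∣2^[d+d]∸1 : ∀ d → 2 ^ d + 1 ∣ 2 ^ (d + d) ∸ 1
2^d+1∣2^[d+d]∸1 d = divides (2 ^ d ∸ 1) (trans (cong (_∸ 1) (^-distribˡ-+-* 2 d d)) (v*v∸1≡[v∸1]*[v+1] (2 ^ d)))

-- 2^d + 1 divides both 2^(d+d) − 1 and 2^i + 2^(i+d), so it would have to divide 1.
d+d≢n : ∀ {n r i d} → K r * (2 ^ i + 2 ^ (i + d)) ≈ 1 [mod 2 ^ n ∸ 1 ] → d + d ≢ n
d+d≢n {n} {r} {i} {d} Kx≈1 refl = contradiction (≈-injective F>0 F>1 0≈1) (λ ())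
  where
  F : ℕ
  F = 2 ^ d + 1
  F>1 : 1 < F
  F>1 = +-monoˡ-≤ 1 (m^n>0 2 d)
  F>0 : 0 < F
  F>0 = <-trans (s≤s z≤n) F>1
  factor : 0 + 2 ^ i * F ≡ 2 ^ i + 2 ^ (i + d)
  factor = trans (expand (2 ^ i) (2 ^ d)) (cong (2 ^ i +_) (sym (^-distribˡ-+-* 2 i d)))
    where
    expand : ∀ a b → 0 + a * (b + 1) ≡ a + a * b
    expand = solve-∀
  x≈0 : 2 ^ i + 2 ^ (i + d) ≈ 0 [mod F ]
  x≈0 = subst (_≈ 0 [mod F ]) factor (+-multiple-≈ 0 (2 ^ i) F)
  0≈1 : 0 ≈ 1 [mod F ]
  0≈1 = begin
    0                                 ≡⟨ *-zeroʳ (K r) ⟨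
    K r * 0                           ≈⟨ *-cong-≈ (≈-refl {K r}) (≈-sym x≈0) ⟩
    K r * (2 ^ i + 2 ^ (i + d))       ≈⟨ ≈-weaken (2^d+1∣2^[d+d]∸1 d) Kx≈1 ⟩
    1                                 ∎
    where open ≈-Reasoning F

sum2^≈[2^t+1]*[1+2^d] : ∀ n .{{_ : NonZero n}} {a a' d t} → a ≈ t [mod n ] → a' ≈ t + d [mod n ] →
              sum2^ (a ∷ a' ∷ 0 ∷ d ∷ []) ≈ (2 ^ t + 1) * (1 + 2 ^ d) [mod 2 ^ n ∸ 1 ]
sum2^≈[2^t+1]*[1+2^d] n {a} {a'} {d} {t} a≈t a'≈t+d = begin
  2 ^ a + (2 ^ a' + (1 + (2 ^ d + 0)))              ≈⟨ +-cong-≈ (2^-cong n a≈t) (+-cong-≈ (2^-cong n a'≈t+d) ≈-refl) ⟩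
  2 ^ t + (2 ^ (t + d) + (1 + (2 ^ d + 0)))         ≡⟨ cong (λ y → 2 ^ t + (y + (1 + (2 ^ d + 0)))) (^-distribˡ-+-* 2 t d) ⟩
  2 ^ t + (2 ^ t * 2 ^ d + (1 + (2 ^ d + 0)))       ≡⟨ factor (2 ^ t) (2 ^ d) ⟩
  (2 ^ t + 1) * (1 + 2 ^ d)                         ∎
  where
  open ≈-Reasoning (2 ^ n ∸ 1)
  factor : ∀ T D → T + (T * D + (1 + (D + 0))) ≡ (T + 1) * (1 + D)
  factor = solve-∀

[2^r+1]*2^j≈sum2^ : ∀ n .{{_ : NonZero n}} {r j e e'} → e ≈ j [mod n ] → e' ≈ r + j [mod n ] →
            (2 ^ r + 1) * 2 ^ j ≈ sum2^ (e' ∷ e ∷ []) [mod 2 ^ n ∸ 1 ]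
[2^r+1]*2^j≈sum2^ n {r} {j} {e} {e'} e≈j e'≈r+j = begin
  (2 ^ r + 1) * 2 ^ j           ≡⟨ expand (2 ^ r) (2 ^ j) ⟩
  2 ^ r * 2 ^ j + (2 ^ j + 0)   ≡⟨ cong (_+ (2 ^ j + 0)) (^-distribˡ-+-* 2 r j) ⟨
  2 ^ (r + j) + (2 ^ j + 0)     ≈⟨ +-cong-≈ (2^-cong n (≈-sym e'≈r+j)) (+-cong-≈ (2^-cong n (≈-sym e≈j)) ≈-refl) ⟩
  sum2^ (e' ∷ e ∷ [])           ∎
  where
  open ≈-Reasoning (2 ^ n ∸ 1)
  expand : ∀ u J → (u + 1) * J ≡ u * J + (J + 0)
  expand = solve-∀

[2^3r+1]*[1+2^d]≈[2^r+1]*2^[n∸i] : ∀ n {r i d} → i ≤ n → K r * (2 ^ i + 2 ^ (i + d)) ≈ 1 [mod 2 ^ n ∸ 1 ] →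
             (2 ^ (3 * r) + 1) * (1 + 2 ^ d) ≈ (2 ^ r + 1) * 2 ^ (n ∸ i) [mod 2 ^ n ∸ 1 ]
[2^3r+1]*[1+2^d]≈[2^r+1]*2^[n∸i] n {r} {i} {d} i≤n Kx≈1 = begin
  (2 ^ (3 * r) + 1) * (1 + D)             ≡⟨ cong (_* (1 + D)) (K-factor r) ⟨
  K r * (u + 1) * (1 + D)                 ≡⟨ cong (K r * (u + 1) *_) (*-identityˡ (1 + D)) ⟨
  K r * (u + 1) * (1 * (1 + D))           ≈⟨ *-cong-≈ (≈-refl {K r * (u + 1)}) (*-cong-≈ 1≈2^n (≈-refl {1 + D})) ⟩
  K r * (u + 1) * (2 ^ n * (1 + D))       ≡⟨ cong (λ p → K r * (u + 1) * (p * (1 + D))) 2^n≡J*I ⟩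
  K r * (u + 1) * (J * I * (1 + D))       ≡⟨ regroup (K r) u J I D ⟩
  (u + 1) * J * (K r * (I + I * D))       ≡⟨ cong (λ y → (u + 1) * J * (K r * (I + y))) (^-distribˡ-+-* 2 i d) ⟨
  (u + 1) * J * (K r * (I + 2 ^ (i + d))) ≈⟨ *-cong-≈ (≈-refl {(u + 1) * J}) Kx≈1 ⟩
  (u + 1) * J * 1                         ≡⟨ *-identityʳ _ ⟩
  (u + 1) * J                             ∎
  where
  open ≈-Reasoning (2 ^ n ∸ 1)
  u D I J : ℕ
  u = 2 ^ r
  D = 2 ^ d
  I = 2 ^ i
  J = 2 ^ (n ∸ i)
  1≈2^n : 1 ≈ 2 ^ n [mod 2 ^ n ∸ 1 ]
  1≈2^n = ≈-sym (2^n≈1 n)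
  2^n≡J*I : 2 ^ n ≡ J * I
  2^n≡J*I = trans (cong (2 ^_) (sym (m∸n+n≡m i≤n))) (^-distribˡ-+-* 2 (n ∸ i) i)
  regroup : ∀ k u J I D → k * (u + 1) * (J * I * (1 + D)) ≡ (u + 1) * J * (k * (I + I * D))
  regroup = solve-∀

inverse-of-2^i+2^j⇒n∤r : ∀ n {r i j} → i < j → 2 ^ i + 2 ^ j < 2 ^ n ∸ 1 →
                          K r * (2 ^ i + 2 ^ j) ≈ 1 [mod 2 ^ n ∸ 1 ] → ¬ n ∣ r
inverse-of-2^i+2^j⇒n∤r n {r} {i} {j} i<j x<M Kx≈1 n∣r =
  <⇒≢ 1<x (sym (≈-injective x<M (<-trans 1<x x<M) (n∣r⇒x≈1 n∣r Kx≈1)))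
  where
  1<x : 1 < 2 ^ i + 2 ^ j
  1<x = +-mono-≤ (m^n>0 2 i) (m^n>0 2 j)

3r%n≡0 : ∀ k {r i d} → Coprime (K r) (2 ^ (6 + k) ∸ 1) → ¬ 6 + k ∣ r → i + d < 6 + k → 1 ≤ d →
          K r * (2 ^ i + 2 ^ (i + d)) ≈ 1 [mod 2 ^ (6 + k) ∸ 1 ] → (3 * r) % (6 + k) ≡ 0
3r%n≡0 k {r} {i} {d} coprime n∤r i+d<n 1≤d Kx≈1 with (3 * r) % (6 + k) ≟ 0
... | yes a≡0 = a≡0
... | no a≢0 =
  ⊥-elim (±3∧3×±1⇒¬coprime k coprime (≈-±-difference e'≈e+r (proj₂ classified))
                                            (≈-±-transˡ (≈-sym (%-≈ (3 * r) n)) (proj₁ classified)))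
  where
  n a a' e e' : ℕ
  n  = 6 + k
  a  = (3 * r) % n
  a' = (a + d) % n
  e  = (n ∸ i) % n
  e' = (r + (n ∸ i)) % n
  d<n : d < n
  d<n = ≤-<-trans (m≤n+m d i) i+d<n
  i≤n : i ≤ n
  i≤n = ≤-trans (m≤m+n i d) (<⇒≤ i+d<n)
  a'≈a+d : a' ≈ a + d [mod n ]
  a'≈a+d = %-≈ (a + d) n
  e'≈e+r : e' ≈ e + r [mod n ]
  e'≈e+r = ≈-trans (%-≈ (r + (n ∸ i)) n)
             (≈-trans (+-cong-≈ (≈-refl {r}) (≈-sym (%-≈ (n ∸ i) n))) (≡⇒≈ (+-comm r e)))
  e'≢e : e' ≢ e
  e'≢e e'≡e =
    n∤r (≈⇒∣∸ z≤n (≈-sym (+-cancelˡ-≈ e (≈-trans (≡⇒≈ (trans (+-identityʳ e) (sym e'≡e))) e'≈e+r))))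
  sums≈ : sum2^ (a ∷ a' ∷ 0 ∷ d ∷ []) ≈ sum2^ (e' ∷ e ∷ []) [mod 2 ^ n ∸ 1 ]
  sums≈ = ≈-trans (sum2^≈[2^t+1]*[1+2^d] n (%-≈ (3 * r) n) (≈-trans a'≈a+d (+-cong-≈ (%-≈ (3 * r) n) (≈-refl {d}))))
          (≈-trans ([2^3r+1]*[1+2^d]≈[2^r+1]*2^[n∸i] n {r} i≤n Kx≈1)
                   ([2^r+1]*2^j≈sum2^ n (%-≈ (n ∸ i) n) (%-≈ (r + (n ∸ i)) n)))
  classified : a ≈ 0 ± 1 [mod n ] × e' ≈ e ± 3 [mod n ]
  classified = Classification.classify (2 + k) (m%n<n (n ∸ i) n) (m%n<n (r + (n ∸ i)) n) e'≢e
                 (m%n<n (3 * r) n) (m%n<n (a + d) n) d<n 1≤d a≢0 (d+d≢n {n} {r} {i} {d} Kx≈1) a'≈a+d sums≈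

wt≡2⇒n∣3r∧n∤r : ∀ k {r x} → Coprime (K r) (2 ^ (6 + k) ∸ 1) → x < 2 ^ (6 + k) ∸ 1 →
                K r * x ≈ 1 [mod 2 ^ (6 + k) ∸ 1 ] → wt x ≡ 2 → 6 + k ∣ 3 * r × ¬ 6 + k ∣ r
wt≡2⇒n∣3r∧n∤r k {r} {x} coprime x<M Kx≈1 wt≡2 with wt≡2⇒2^+2^ x wt≡2
... | i , j , i<j , refl = m%n≡0⇒n∣m (3 * r) n (3r%n≡0 k coprime n∤r i+d<n (m<n⇒0<n∸m i<j) Kx'≈1) , n∤r
  where
  n : ℕ
  n = 6 + k
  n∤r : ¬ n ∣ r
  n∤r = inverse-of-2^i+2^j⇒n∤r n i<j x<M Kx≈1
  i+d≡j : i + (j ∸ i) ≡ j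
  i+d≡j = m+[n∸m]≡n (<⇒≤ i<j)
  j<n : j < n
  j<n = ≰⇒> λ n≤j →
    <-irrefl refl (<-≤-trans x<M (≤-trans (m∸n≤m (2 ^ n) 1) (≤-trans (^-monoʳ-≤ 2 n≤j) (m≤n+m _ _))))
  i+d<n : i + (j ∸ i) < n
  i+d<n = subst (_< n) (sym i+d≡j) j<n
  Kx'≈1 : K r * (2 ^ i + 2 ^ (i + (j ∸ i))) ≈ 1 [mod 2 ^ n ∸ 1 ]
  Kx'≈1 = subst (λ e → K r * (2 ^ i + 2 ^ e) ≈ 1 [mod 2 ^ n ∸ 1 ]) (sym i+d≡j) Kx≈1

-- The inverse when n b = 3 r

inverse≈ : ∀ n .{{_ : NonZero n}} {r b x} → n * b ≡ 3 * r → K r * x ≈ 1 [mod 2 ^ n ∸ 1 ] →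
           x ≈ 2 ^ (n ∸ 1 + r) + 2 ^ (n ∸ 1) [mod 2 ^ n ∸ 1 ]
inverse≈ n {r} {b} {x} nb≡3r Kx≈1 = begin
  x                                  ≡⟨ *-identityˡ x ⟨
  1 * x                              ≈⟨ *-cong-≈ (≈-sym (2^n≈1 n)) (≈-refl {x}) ⟩
  2 ^ n * x                          ≡⟨ cong (_* x) (2^n≡2^[n∸1]*2 n) ⟩
  H * 2 * x                          ≈⟨ *-cong-≈ (*-cong-≈ (≈-refl {H}) 2≈2^[3r]+1) (≈-refl {x}) ⟩
  H * (2 ^ (3 * r) + 1) * x          ≡⟨ cong (λ y → H * y * x) (K-factor r) ⟨
  H * (K r * (u + 1)) * x            ≡⟨ regroup H (K r) u x ⟩
  H * (u + 1) * (K r * x)            ≈⟨ *-cong-≈ (≈-refl {H * (u + 1)}) Kx≈1 ⟩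
  H * (u + 1) * 1                    ≡⟨ expand H u ⟩
  H * u + H                          ≡⟨ cong (_+ H) (^-distribˡ-+-* 2 (n ∸ 1) r) ⟨
  2 ^ (n ∸ 1 + r) + 2 ^ (n ∸ 1)      ∎
  where
  open ≈-Reasoning (2 ^ n ∸ 1)
  H u : ℕ
  H = 2 ^ (n ∸ 1)
  u = 2 ^ r
  2^[3r]≈1 : 2 ^ (3 * r) ≈ 1 [mod 2 ^ n ∸ 1 ]
  2^[3r]≈1 = subst (λ e → 2 ^ e ≈ 1 [mod 2 ^ n ∸ 1 ]) (trans (*-comm b n) nb≡3r) (2^-periodic n 0 b)
  2≈2^[3r]+1 : 2 ≈ 2 ^ (3 * r) + 1 [mod 2 ^ n ∸ 1 ]
  2≈2^[3r]+1 = +-cong-≈ (≈-sym 2^[3r]≈1) (≈-refl {1})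
  regroup : ∀ H k u x → H * (k * (u + 1)) * x ≡ H * (u + 1) * (k * x)
  regroup = solve-∀
  expand : ∀ H u → H * (u + 1) * 1 ≡ H * u + H
  expand = solve-∀

prime∤⇒gcd≡1 : ∀ {p b} → Prime p → ¬ p ∣ b → gcd b p ≡ 1
prime∤⇒gcd≡1 {p} {b} p-prime p∤b with prime⇒irreducible p-prime (gcd[m,n]∣n b p)
... | inj₁ gcd≡1 = gcd≡1
... | inj₂ gcd≡p = contradiction (subst (_∣ b) gcd≡p (gcd[m,n]∣m b p)) p∤b

gcd≡1⇒¬∣ : ∀ {p b} → 1 < p → gcd b p ≡ 1 → ¬ p ∣ b
gcd≡1⇒¬∣ {p} {b} 1<p gcd≡1 p∣b = <⇒≢ 1<p (sym (∣1⇒≡1 (subst (p ∣_) gcd≡1 (gcd-greatest p∣b ∣-refl))))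

gcd≡1⇒3∣n : ∀ {n r b} → gcd b 3 ≡ 1 → n * b ≡ 3 * r → 3 ∣ n
gcd≡1⇒3∣n {n} {r} {b} gcd≡1 nb≡3r =
  coprime-divisor (Coprime-sym (gcd≡1⇒coprime {b} {3} gcd≡1)) (divides r (trans (*-comm b n) (trans nb≡3r (*-comm 3 r))))

decompose : ∀ {n r b} → gcd b 3 ≡ 1 → n * b ≡ 3 * r → ∃[ t ] (n ≡ t * 3 × r ≡ t * b)
decompose {n} {r} {b} gcd≡1 nb≡3r with gcd≡1⇒3∣n {n} {r} {b} gcd≡1 nb≡3r
... | divides t refl = t , refl , *-cancelʳ-≡ r (t * b) 3 (begin
  r * 3          ≡⟨ *-comm r 3 ⟩
  3 * r          ≡⟨ nb≡3r ⟨
  t * 3 * b      ≡⟨ swap t 3 b ⟩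
  t * b * 3      ∎)
  where
  open ≡-Reasoning
  swap : ∀ x y z → x * y * z ≡ x * z * y
  swap = solve-∀

1≤b%3 : ∀ b → gcd b 3 ≡ 1 → 1 ≤ b % 3
1≤b%3 b gcd≡1 with b % 3 in b%3≡c
... | zero  = contradiction (m%n≡0⇒n∣m b 3 b%3≡c) (gcd≡1⇒¬∣ (s≤s (s≤s z≤n)) gcd≡1)
... | suc _ = s≤s z≤n

c*[t*3]/3≡c*t : ∀ c t → c * (t * 3) / 3 ≡ c * t
c*[t*3]/3≡c*t c t = trans (cong (_/ 3) (sym (*-assoc c t 3))) (m*n/n≡m (c * t) 3)

wrapped-exponent : ∀ n .{{_ : NonZero n}} {r b} → gcd b 3 ≡ 1 → n * b ≡ 3 * r →
                   n ∸ 1 + r ≡ (b % 3 * n / 3 ∸ 1) + suc (b / 3) * n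
wrapped-exponent n {r} {b} gcd≡1 nb≡3r with decompose {n} {r} {b} gcd≡1 nb≡3r
... | zero  , n≡0 , _ = contradiction n≡0 (≢-nonZero⁻¹ n)
... | suc t , refl , refl with b % 3 | b / 3 | m≡m%n+[m/n]*n b 3 | 1≤b%3 b gcd≡1
...   | suc c | q | refl | _ =
  trans (expand t c q) (cong (λ s → s ∸ 1 + suc q * (suc t * 3)) (sym (c*[t*3]/3≡c*t (suc c) (suc t))))
  where
  expand : ∀ t c q → (2 + t * 3) + suc t * (suc c + q * 3) ≡ (t + c * suc t) + suc q * (suc t * 3)
  expand = solve-∀

wrapped-exponent<n∸1 : ∀ n .{{_ : NonZero n}} {r b} → gcd b 3 ≡ 1 → n * b ≡ 3 * r → b % 3 * n / 3 ∸ 1 < n ∸ 1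
wrapped-exponent<n∸1 n {r} {b} gcd≡1 nb≡3r with decompose {n} {r} {b} gcd≡1 nb≡3r
... | zero  , n≡0 , _ = contradiction n≡0 (≢-nonZero⁻¹ n)
... | suc t , refl , _ =
  subst (_< suc t * 3 ∸ 1) (cong (_∸ 1) (sym (c*[t*3]/3≡c*t (b % 3) (suc t)))) (∸-monoˡ-< c*t<t*3 1≤c*t)
  where
  c*t<t*3 : b % 3 * suc t < suc t * 3
  c*t<t*3 = subst (b % 3 * suc t <_) (*-comm 3 (suc t)) (*-monoˡ-< (suc t) (m%n<n b 3))
  1≤c*t : 1 ≤ b % 3 * suc t
  1≤c*t = *-mono-≤ (1≤b%3 b gcd≡1) (s≤s z≤n)

inverse-closed-form : ∀ n .{{_ : NonZero n}} {r b x} → gcd b 3 ≡ 1 → n * b ≡ 3 * r → K r * x ≈ 1 [mod 2 ^ n ∸ 1 ] →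
                      x ≈ 2 ^ (n ∸ 1) + 2 ^ (b % 3 * n / 3 ∸ 1) [mod 2 ^ n ∸ 1 ]
inverse-closed-form n {r} {b} {x} gcd≡1 nb≡3r Kx≈1 = begin
  x                                        ≈⟨ inverse≈ n {r} nb≡3r Kx≈1 ⟩
  2 ^ (n ∸ 1 + r) + 2 ^ (n ∸ 1)            ≡⟨ cong (λ e → 2 ^ e + 2 ^ (n ∸ 1)) (wrapped-exponent n gcd≡1 nb≡3r) ⟩
  2 ^ (s + suc (b / 3) * n) + 2 ^ (n ∸ 1)  ≈⟨ +-cong-≈ (2^-periodic n s (suc (b / 3))) (≈-refl {2 ^ (n ∸ 1)}) ⟩
  2 ^ s + 2 ^ (n ∸ 1)                      ≡⟨ +-comm (2 ^ s) (2 ^ (n ∸ 1)) ⟩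
  2 ^ (n ∸ 1) + 2 ^ s                      ∎
  where
  open ≈-Reasoning (2 ^ n ∸ 1)
  s : ℕ
  s = b % 3 * n / 3 ∸ 1

inverse-formulas : ∀ n .{{_ : NonZero n}} {r b x} → gcd b 3 ≡ 1 → n * b ≡ 3 * r → K r * x ≈ 1 [mod 2 ^ n ∸ 1 ] →
                   (b % 3 ≡ 1 → x ≈ 2 ^ (n ∸ 1) + 2 ^ (n / 3 ∸ 1) [mod 2 ^ n ∸ 1 ]) ×
                   (b % 3 ≡ 2 → x ≈ 2 ^ (n ∸ 1) + 2 ^ ((2 * n) / 3 ∸ 1) [mod 2 ^ n ∸ 1 ])
inverse-formulas n {r} {b} {x} gcd≡1 nb≡3r Kx≈1 =
  (λ b%3≡1 → subst (closed-form-at) (trans (cong (_* n) b%3≡1) (*-identityˡ n)) closed-form) ,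
  (λ b%3≡2 → subst (closed-form-at) (cong (_* n) b%3≡2) closed-form)
  where
  closed-form-at : ℕ → Set
  closed-form-at m = x ≈ 2 ^ (n ∸ 1) + 2 ^ (m / 3 ∸ 1) [mod 2 ^ n ∸ 1 ]
  closed-form : closed-form-at (b % 3 * n)
  closed-form = inverse-closed-form n {r} gcd≡1 nb≡3r Kx≈1

≈2^i+2^j⇒wt≡2 : ∀ {n x i j} → 1 ≤ x → x < 2 ^ n ∸ 1 → i < j → j < n →
                x ≈ 2 ^ i + 2 ^ j [mod 2 ^ n ∸ 1 ] → wt x ≡ 2
≈2^i+2^j⇒wt≡2 {n} {x} {i} {j} 1≤x x<M i<j j<n x≈2^i+2^j = subst (λ y → wt y ≡ 2) (sym x≡2^i+2^j) (wt-2^+2^ i<j)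
  where
  2^i+2^j<2^n : 2 ^ i + 2 ^ j < 2 ^ n
  2^i+2^j<2^n = subst (_< 2 ^ n) (cong (2 ^ i +_) (+-identityʳ (2 ^ j)))
                  (sum2^<2^ n (((<⇒≢ i<j) ∷ []) ∷ [] ∷ []) (<-trans i<j j<n ∷ j<n ∷ []))
  x≡2^i+2^j : x ≡ 2 ^ i + 2 ^ j
  x≡2^i+2^j = ≈-injective-pos 1≤x (≤-trans (m^n>0 2 i) (m≤m+n _ _)) (<⇒≤ x<M) (∸-monoˡ-≤ 1 2^i+2^j<2^n) x≈2^i+2^j

exponent-ratio : ∀ {n r} → 1 ≤ r → n ∣ 3 * r → ¬ n ∣ r →
                 ∃[ b ] (1 ≤ b × b ∣ r × gcd b 3 ≡ 1 × n * b ≡ 3 * r)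
exponent-ratio {r = zero}  () _ _
exponent-ratio {r = suc r} _ (divides zero ()) _
exponent-ratio {n} {r} _ (divides (suc b) 3r≡b*n) n∤r =
  suc b , s≤s z≤n , divides (proj₁ t) (proj₂ (proj₂ t)) , gcd≡1 , nb≡3r
  where
  nb≡3r : n * suc b ≡ 3 * r
  nb≡3r = trans (*-comm n (suc b)) (sym 3r≡b*n)
  3∤b : ¬ 3 ∣ suc b
  3∤b (divides c b≡c*3) = n∤r (divides c (*-cancelʳ-≡ r (c * n) 3 (begin
    r * 3          ≡⟨ *-comm r 3 ⟩
    3 * r          ≡⟨ 3r≡b*n ⟩
    suc b * n      ≡⟨ cong (_* n) b≡c*3 ⟩
    c * 3 * n      ≡⟨ swap c 3 n ⟩
    c * n * 3      ∎)))
    where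
    open ≡-Reasoning
    swap : ∀ x y z → x * y * z ≡ x * z * y
    swap = solve-∀
  gcd≡1 : gcd (suc b) 3 ≡ 1
  gcd≡1 = prime∤⇒gcd≡1 (from-yes (prime? 3)) 3∤b
  t : ∃[ t ] (n ≡ t * 3 × r ≡ t * suc b)
  t = decompose {n} {r} {suc b} gcd≡1 nb≡3r

proposition10 : (n r : ℕ) → 6 ≤ n → 1 ≤ r →
    Coprime (K r) (2 ^ n ∸ 1) →
    (x : ℕ) → 1 ≤ x → x < 2 ^ n ∸ 1 → K r * x ≡ 1 [mod (2 ^ n ∸ 1) ] →
    ((wt x ≡ 2) ⇔ (∃[ b ] (1 ≤ b × b ∣ r × gcd b 3 ≡ 1 × n * b ≡ 3 * r)))
    × ((b : ℕ) → 1 ≤ b → b ∣ r → gcd b 3 ≡ 1 → n * b ≡ 3 * r →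
        (b % 3 ≡ 1 → x ≡ 2 ^ (n ∸ 1) + 2 ^ (n / 3 ∸ 1) [mod (2 ^ n ∸ 1) ])
        × (b % 3 ≡ 2 → x ≡ 2 ^ (n ∸ 1) + 2 ^ ((2 * n) / 3 ∸ 1) [mod (2 ^ n ∸ 1) ]))
proposition10 n r 6≤n 1≤r coprime x 1≤x x<M Kx≡1 with k , refl ← m≤n⇒∃[o]m+o≡n 6≤n =
  mk⇔ weight-two⇒ratio ratio⇒weight-two , formulas
  where
  Kx≈1 : K r * x ≈ 1 [mod 2 ^ n ∸ 1 ]
  Kx≈1 = mk≈ Kx≡1
  weight-two⇒ratio : wt x ≡ 2 → ∃[ b ] (1 ≤ b × b ∣ r × gcd b 3 ≡ 1 × n * b ≡ 3 * r)
  weight-two⇒ratio wt≡2 = uncurry (exponent-ratio 1≤r) (wt≡2⇒n∣3r∧n∤r k coprime x<M Kx≈1 wt≡2)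
  ratio⇒weight-two : ∃[ b ] (1 ≤ b × b ∣ r × gcd b 3 ≡ 1 × n * b ≡ 3 * r) → wt x ≡ 2
  ratio⇒weight-two (b , _ , _ , gcd≡1 , nb≡3r) =
    ≈2^i+2^j⇒wt≡2 1≤x x<M (wrapped-exponent<n∸1 n {r} {b} gcd≡1 nb≡3r) ≤-refl
      (≈-trans (inverse-closed-form n {r} {b} gcd≡1 nb≡3r Kx≈1) (≡⇒≈ (+-comm (2 ^ (n ∸ 1)) _)))
  formulas : (b : ℕ) → 1 ≤ b → b ∣ r → gcd b 3 ≡ 1 → n * b ≡ 3 * r →
             (b % 3 ≡ 1 → x ≡ 2 ^ (n ∸ 1) + 2 ^ (n / 3 ∸ 1) [mod (2 ^ n ∸ 1) ])
             × (b % 3 ≡ 2 → x ≡ 2 ^ (n ∸ 1) + 2 ^ ((2 * n) / 3 ∸ 1) [mod (2 ^ n ∸ 1) ])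
  formulas b _ _ gcd≡1 nb≡3r = Product.map (≡-mod ∘_) (≡-mod ∘_) (inverse-formulas n {r} {b} gcd≡1 nb≡3r Kx≈1)
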